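{- Let $\mathrm{Sunlet}_4$ be the undirected graph with vertex set $\{v_1,\dots,v_8\}$ and edge set $\{v_2v_3, v_2v_5, v_5v_8, v_8v_3, v_3v_4, v_2v_1, v_5v_6, v_8v_7\}$ (a 4-cycle $v_3v_2v_5v_8$ with one pendant vertex attached to each cycle vertex). Then $\mathrm{Sunlet}_4$ is $(P_6,C_6)$-free, and it is a forbidden induced subgraph for the class of un2qBMGs: $\mathrm{Sunlet}_4$ is not an un2qBMG, and no un2qBMG contains an induced subgraph isomorphic to $\mathrm{Sunlet}_4$.
   Context: A rooted phylogenetic tree $T$ is a rooted tree with root $\rho$ in which every non-leaf vertex has at least two children; $L=L(T)$ denotes its leaf set. Write $v\preceq_T u$ if $u$ lies on the path from $\rho$ to $v$, and $\mathrm{lca}_T(x,y)$ for the $\preceq_T$-smallest common ancestor of $x,y$. Let $\sigma\colon L\to S$ be a leaf coloring, where $S$ is a set of two colors. For leaves $x,y$ with $\sigma(x)\neq\sigma(y)$, $y$ is a best match of $x$ if $\mathrm{lca}_T(x,y)\preceq_T\mathrm{lca}_T(x,y')$ for all leaves $y'$ with $\sigma(y')=\sigma(y)$. A truncation map $u_T\colon L\times S\to V(T)$ assigns to each leaf $x$ and color $s$ a vertex on the path from $\rho$ to $x$, with $u_T(x,\sigma(x))=x$. A leaf $y$ is a quasi-best match of $x$ if $y$ is a best match of $x$ and $\mathrm{lca}_T(x,y)\preceq_T u_T(x,\sigma(y))$. The quasi-best match graph of $(T,\sigma,u_T)$ is the vertex-colored digraph on $L$ (colored by $\sigma$) with an arc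 $xy$ iff $y$ is a quasi-best match of $x$. A 2qBMG is a vertex-colored digraph with two colors that arises in this way. (Known equivalent characterization: a digraph with a proper 2-coloring is a 2qBMG iff (N1) there are no four distinct vertices $u,t,w,v$ with $u,v$ non-adjacent and $ut, vw, tw$ arcs; (N2) whenever $uv,vw,wt$ are arcs, $ut$ is an arc; (N3) for distinct $u,v$, if $N^+(u)\cap N^+(v)\neq\emptyset$ then $N^+(u)\subseteq N^+(v)$ or $N^+(v)\subseteq N^+(u)$.) The underlying undirected graph of a digraph has the same vertex set and an edge $uv$ whenever $uv$ or $vu$ is an arc. An un2qBMG is the underlying undirected graph of some 2qBMG. A graph is $(P_6,C_6)$-free if it has no induced subgraph isomorphic to the path on six vertices nor to the cycle on six vertices. -}

module Defs where

open import Data.Nat using (ℕ; zero; suc)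
open import Data.Fin using (Fin; zero; suc; _≟_)
open import Data.Fin.Patterns
open import Data.Fin.Properties using (all?)
open import Data.Bool using (Bool)
open import Data.Product using (Σ; _×_; _,_; ∃; ∃-syntax)
open import Data.Sum using (_⊎_; inj₁; inj₂)
open import Data.List using (List; []; _∷_)
open import Data.List.Relation.Unary.Any using (Any)
open import Relation.Nullary using (¬_; yes; no)
open import Relation.Nullary.Decidable using (toWitness; ¬?; _⊎-dec_)
open import Data.List.Relation.Unary.Any using (any?)
open import Data.Product.Properties using (≡-dec)
open import Relation.Binary.PropositionalEquality using (_≡_; _≢_; refl)
open import Function.Bundles using (_⇔_; _↔_; Inverse)
open import Function.Definitions using (Injective)

data Tree : Set where
  leaf : Tree
  node : (k : ℕ) → (Fin (suc (suc k)) → Tree) → Tree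

-- Vertices of a tree, given as positions (paths from the root ρ).
data Pos : Tree → Set where
  here  : ∀ {t} → Pos t
  there : ∀ {k} {f : Fin (suc (suc k)) → Tree} (i : Fin (suc (suc k))) →
          Pos (f i) → Pos (node k f)

root : ∀ {t} → Pos t
root = here

-- v ≼ u  :  u lies on the path from ρ to v  (v ⪯_T u).
data _≼_ : ∀ {t} → Pos t → Pos t → Set where
  ≼-here  : ∀ {t} {v : Pos t} → v ≼ here
  ≼-there : ∀ {k} {f : Fin (suc (suc k)) → Tree} {i : Fin (suc (suc k))}
              {v u : Pos (f i)} → v ≼ u → there {f = f} i v ≼ there i u

data IsLeaf : ∀ {t} → Pos t → Set where
  leaf-here  : IsLeaf {leaf} here
  leaf-there : ∀ {k} {f : Fin (suc (suc k)) → Tree} {i : Fin (suc (suc k))}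
                 {p : Pos (f i)} → IsLeaf p → IsLeaf (there {f = f} i p)

Leaf : Tree → Set
Leaf t = Σ (Pos t) IsLeaf

pos : ∀ {t} → Leaf t → Pos t
pos (p , _) = p

lca : ∀ {t} → Pos t → Pos t → Pos t
lca here q = here
lca (there i p) here = here
lca (there i p) (there j q) with i ≟ j
... | yes refl = there i (lca p q)
... | no _     = here

Color : Set
Color = Bool

module _ {t : Tree} (σ : Leaf t → Color) where

  BestMatch : Leaf t → Leaf t → Set
  BestMatch x y =
    σ x ≢ σ y ×
    (∀ (y' : Leaf t) → σ y' ≡ σ y → lca (pos x) (pos y) ≼ lca (pos x) (pos y'))

  record Truncation : Set where
    field
      u      : Leaf t → Color → Pos t
      onPath : ∀ x s → pos x ≼ u x s
      atOwn  : ∀ x → u x (σ x) ≡ pos x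

  QuasiBestMatch : Truncation → Leaf t → Leaf t → Set
  QuasiBestMatch uT x y =
    BestMatch x y × lca (pos x) (pos y) ≼ Truncation.u uT x (σ y)

record ColDigraph (n : ℕ) : Set₁ where
  field
    Arc : Fin n → Fin n → Set
    col : Fin n → Color

Is2qBMG : ∀ {n} → ColDigraph n → Set
Is2qBMG {n} D =
  Σ Tree λ t →
  Σ (Fin n ↔ Leaf t) λ φ →
  let open Inverse φ
      σ : Leaf t → Color
      σ ℓ = ColDigraph.col D (from ℓ)
  in Σ (Truncation σ) λ uT →
     ∀ x y → (ColDigraph.Arc D x y ⇔ QuasiBestMatch σ uT (to x) (to y))

record Graph (n : ℕ) : Set₁ where
  field
    E      : Fin n → Fin n → Set
    E-sym  : ∀ {x y} → E x y → E y x
    E-irr  : ∀ {x} → ¬ E x x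

Underlying : ∀ {n} → ColDigraph n → Graph n → Set
Underlying D G =
  ∀ x y → (Graph.E G x y ⇔ (ColDigraph.Arc D x y ⊎ ColDigraph.Arc D y x))

IsUn2qBMG : ∀ {n} → Graph n → Set₁
IsUn2qBMG {n} G = Σ (ColDigraph n) λ D → Is2qBMG D × Underlying D G

HasInduced : ∀ {k n} → Graph k → Graph n → Set
HasInduced {k} {n} H G =
  Σ (Fin k → Fin n) λ f →
    Injective _≡_ _≡_ f × (∀ i j → (Graph.E H i j ⇔ Graph.E G (f i) (f j)))

EdgeIn : ∀ {n} → List (Fin n × Fin n) → Fin n → Fin n → Set
EdgeIn es x y = Any (λ e → e ≡ (x , y)) es ⊎ Any (λ e → e ≡ (y , x)) es

edgeIn? : ∀ {n} (es : List (Fin n × Fin n)) x y → Relation.Nullary.Dec (EdgeIn es x y)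
edgeIn? es x y =
  any? (λ e → ≡-dec _≟_ _≟_ e (x , y)) es ⊎-dec any? (λ e → ≡-dec _≟_ _≟_ e (y , x)) es

fromEdges : ∀ {n} (es : List (Fin n × Fin n)) →
            {loopless : Relation.Nullary.Decidable.True (all? (λ x → ¬? (edgeIn? es x x)))} →
            Graph n
fromEdges es {ll} = record
  { E     = EdgeIn es
  ; E-sym = λ { (inj₁ p) → inj₂ p ; (inj₂ p) → inj₁ p }
  ; E-irr = λ {x} → toWitness ll x
  }

-- Sunlet₄ : vertices v₁,…,v₈ are 0,…,7; edges
-- v2v3, v2v5, v5v8, v8v3, v3v4, v2v1, v5v6, v8v7.
Sunlet4 : Graph 8
Sunlet4 = fromEdges
  ( (1F , 2F) ∷ (1F , 4F) ∷ (4F , 7F) ∷ (7F , 2F)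
  ∷ (2F , 3F) ∷ (1F , 0F) ∷ (4F , 5F) ∷ (7F , 6F) ∷ [])

P6 : Graph 6
P6 = fromEdges ((0F , 1F) ∷ (1F , 2F) ∷ (2F , 3F) ∷ (3F , 4F) ∷ (4F , 5F) ∷ [])

C6 : Graph 6
C6 = fromEdges ((0F , 1F) ∷ (1F , 2F) ∷ (2F , 3F) ∷ (3F , 4F) ∷ (4F , 5F) ∷ (5F , 0F) ∷ [])

P6C6Free : ∀ {n} → Graph n → Set
P6C6Free G = ¬ HasInduced P6 G × ¬ HasInduced C6 G

-- Quasi-best match graphs obey (N1)–(N3); these are universal
-- statements, so they survive restriction to any vertex subset.  Orient the
-- edges of an induced Sunlet₄ as a 2qBMG would: whichever way the cycle edge
-- v₂v₃ points, its head is the middle vertex of an induced P₅ (v₁v₂v₃v₈v₇ or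
-- v₄v₃v₂v₅v₆) whose second vertex points into it, and (N1)–(N3) rule out
-- every orientation of the two adjacent path edges.  (P₆,C₆)-freeness: the
-- pendant vertices have degree one, so the vertices of degree two in an
-- induced path or cycle land in the 4-cycle; six of them cannot fit, and a
-- walk of length three between distinct vertices of C₄ = K₂,₂ joins
-- adjacent ones, which P₆ forbids for its four inner vertices.
module Submission where

open import Defs
open import Data.Nat using (ℕ; _<_; s≤s; z≤n)
open import Data.Fin using (Fin; _≟_)
open import Data.Fin.Patterns
open import Data.Fin.Properties using (all?; any?; pigeonhole; <⇒≢)
open import Data.Bool.Properties using (¬-not)
open import Data.Product using (_×_; _,_; ∃; proj₁; proj₂)
open import Data.Sum using (_⊎_; inj₁; inj₂; [_,_]; map)
open import Data.Empty using (⊥; ⊥-elim)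
open import Function using (_∘_; id)
open import Function.Bundles using (_⇔_; Equivalence; Inverse)
open import Function.Construct.Composition using (_⇔-∘_)
open import Function.Construct.Identity using (⇔-id)
open import Relation.Nullary using (¬_; Dec; yes; no)
open import Relation.Nullary.Decidable
  using (True; False; toWitness; toWitnessFalse; ¬?; _→-dec_)
open import Relation.Nullary.Decidable.Core using (¬¬-excluded-middle)
open import Relation.Binary.PropositionalEquality
  using (_≡_; _≢_; refl; sym; trans; subst; cong; ≢-sym)

≼-trans : ∀ {t} {a b c : Pos t} → a ≼ b → b ≼ c → a ≼ c
≼-trans _           ≼-here      = ≼-here
≼-trans (≼-there p) (≼-there q) = ≼-there (≼-trans p q)

≼-lcaˡ : ∀ {t} (p q : Pos t) → p ≼ lca p q
≼-lcaˡ here        q = ≼-here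
≼-lcaˡ (there i p) here = ≼-here
≼-lcaˡ (there i p) (there j q) with i ≟ j
... | yes refl = ≼-there (≼-lcaˡ p q)
... | no _     = ≼-here

≼-lcaʳ : ∀ {t} (p q : Pos t) → q ≼ lca p q
≼-lcaʳ here        q = ≼-here
≼-lcaʳ (there i p) here = ≼-here
≼-lcaʳ (there i p) (there j q) with i ≟ j
... | yes refl = ≼-there (≼-lcaʳ p q)
... | no _     = ≼-here

lca-least : ∀ {t} {p q z : Pos t} → p ≼ z → q ≼ z → lca p q ≼ z
lca-least _ ≼-here = ≼-here
lca-least {p = there i p} {q = there .i q} (≼-there a) (≼-there b) with i ≟ i
... | yes refl = ≼-there (lca-least a b)
... | no i≢i   = ⊥-elim (i≢i refl)

lca-comm-≼ : ∀ {t} (p q : Pos t) → lca q p ≼ lca p q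
lca-comm-≼ p q = lca-least (≼-lcaʳ p q) (≼-lcaˡ p q)

ancestors-comparable : ∀ {t} {p a b : Pos t} → p ≼ a → p ≼ b → a ≼ b ⊎ b ≼ a
ancestors-comparable _ ≼-here = inj₁ ≼-here
ancestors-comparable ≼-here _ = inj₂ ≼-here
ancestors-comparable (≼-there x) (≼-there y) with ancestors-comparable x y
... | inj₁ r = inj₁ (≼-there r)
... | inj₂ r = inj₂ (≼-there r)

≢-≢⇒≡ : {a b c : Color} → a ≢ b → b ≢ c → a ≡ c
≢-≢⇒≡ a≢b b≢c = trans (¬-not a≢b) (sym (¬-not (≢-sym b≢c)))

-- (N3) in pointwise form: a common out-neighbour w makes the out-neighbourhoods
-- of u and v comparable.  (N1) and (N3) carry no distinctness side conditions;
-- quasi-best match graphs satisfy them even so.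
record QBMGProperties {V : Set} (R : V → V → Set) : Set where
  field
    n1 : ∀ {u t w v} → R u t → R v w → R t w → ¬ R u v → ¬ R v u → ⊥
    n2 : ∀ {u v w t} → R u v → R v w → R w t → R u t
    n3 : ∀ {u v w x y} → R u w → R v w → R u x → R v y → R v x ⊎ R u y

module _ {V : Set} {R S : V → V → Set} where

  QBMGProperties-⇔ : (∀ x y → R x y ⇔ S x y) → QBMGProperties S → QBMGProperties R
  QBMGProperties-⇔ R⇔S P = record
    { n1 = λ ut vw tw ¬uv ¬vu → n1 (to ut) (to vw) (to tw) (¬uv ∘ from) (¬vu ∘ from)
    ; n2 = λ uv vw wt → from (n2 (to uv) (to vw) (to wt))
    ; n3 = λ uw vw ux vy → map from from (n3 (to uw) (to vw) (to ux) (to vy))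
    }
    where
    open QBMGProperties P
    to : ∀ {x y} → R x y → S x y
    to {x} {y} = Equivalence.to (R⇔S x y)
    from : ∀ {x y} → S x y → R x y
    from {x} {y} = Equivalence.from (R⇔S x y)

QBMGProperties-comap : ∀ {V W : Set} {R : V → V → Set} (f : W → V) →
                       QBMGProperties R → QBMGProperties (λ x y → R (f x) (f y))
QBMGProperties-comap f P = record { n1 = n1 ; n2 = n2 ; n3 = n3 }
  where open QBMGProperties P

module QuasiBestMatchGraph {t : Tree} (σ : Leaf t → Color) (uT : Truncation σ) where
  open Truncation uT

  private
    Q : Leaf t → Leaf t → Set
    Q = QuasiBestMatch σ uT

    m : Leaf t → Leaf t → Pos t
    m x y = lca (pos x) (pos y)

    colors-differ : ∀ {x y} → Q x y → σ x ≢ σ y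
    colors-differ ((x≢y , _) , _) = x≢y

    best : ∀ {x y} → Q x y → ∀ y' → σ y' ≡ σ y → m x y ≼ m x y'
    best ((_ , b) , _) = b

  closer-quasiBestMatch : ∀ {x y z} → Q x y → σ z ≡ σ y → m x z ≼ m x y → Q x z
  closer-quasiBestMatch {x} {y} {z} ((x≢y , y-best) , y-within) σz≡σy xz≼xy =
    ((x≢y ∘ (λ e → trans e σz≡σy)) ,
     (λ z' σz'≡σz → ≼-trans xz≼xy (y-best z' (trans σz'≡σz σz≡σy)))) ,
    ≼-trans xz≼xy (subst (λ c → m x y ≼ u x c) (sym σz≡σy) y-within)

  n2 : ∀ {a b c d} → Q a b → Q b c → Q c d → Q a d
  n2 {a} {b} {c} {d} ab bc cd = closer-quasiBestMatch ab (sym σb≡σd) ad≼ab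
    where
    σb≡σd : σ b ≡ σ d
    σb≡σd = ≢-≢⇒≡ (colors-differ bc) (colors-differ cd)
    σa≡σc : σ a ≡ σ c
    σa≡σc = ≢-≢⇒≡ (colors-differ ab) (colors-differ bc)
    d≼ab : pos d ≼ m a b
    d≼ab = ≼-trans (≼-lcaʳ (pos c) (pos d))
             (≼-trans (best cd b σb≡σd)
             (≼-trans (lca-comm-≼ (pos b) (pos c))
             (≼-trans (best bc a σa≡σc) (lca-comm-≼ (pos a) (pos b)))))
    ad≼ab : m a d ≼ m a b
    ad≼ab = lca-least (≼-lcaˡ (pos a) (pos b)) d≼ab

  n1 : ∀ {u t' w v} → Q u t' → Q v w → Q t' w → ¬ Q u v → ¬ Q v u → ⊥
  n1 {u} {t'} {w} {v} ut vw tw ¬uv ¬vu =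
    ¬¬-excluded-middle λ
      { (yes vu≼vw) → ¬vu (closer-quasiBestMatch vw σu≡σw vu≼vw)
      ; (no vu⋠vw)  → ¬uv (closer-quasiBestMatch ut σv≡σt (uv≼ut vu⋠vw)) }
    where
    σu≡σw : σ u ≡ σ w
    σu≡σw = ≢-≢⇒≡ (colors-differ ut) (colors-differ tw)
    σv≡σt : σ v ≡ σ t'
    σv≡σt = ≢-≢⇒≡ (colors-differ vw) (≢-sym (colors-differ tw))
    -- lca(v,w) and lca(w,u) are both ancestors of w, hence comparable.
    vu≼wu : ¬ (m v u ≼ m v w) → m v u ≼ m w u
    vu≼wu vu⋠vw with ancestors-comparable (≼-lcaʳ (pos v) (pos w)) (≼-lcaˡ (pos w) (pos u))
    ... | inj₁ vw≼wu = lca-least (≼-trans (≼-lcaˡ (pos v) (pos w)) vw≼wu) (≼-lcaʳ (pos w) (pos u))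
    ... | inj₂ wu≼vw = ⊥-elim (vu⋠vw (lca-least (≼-lcaˡ (pos v) (pos w))
                                       (≼-trans (≼-lcaʳ (pos w) (pos u)) wu≼vw)))
    wu≼ut : m w u ≼ m u t'
    wu≼ut = ≼-trans (lca-least (≼-trans (≼-lcaʳ (pos t') (pos w)) (best tw u σu≡σw))
                               (≼-lcaʳ (pos t') (pos u)))
                    (lca-comm-≼ (pos u) (pos t'))
    uv≼ut : ¬ (m v u ≼ m v w) → m u v ≼ m u t'
    uv≼ut vu⋠vw = ≼-trans (lca-comm-≼ (pos v) (pos u)) (≼-trans (vu≼wu vu⋠vw) wu≼ut)

  -- The two lcas with w are ancestors of w, hence comparable; the lower
  -- one makes w a quasi-best match replacing x (resp. y).
  n3 : ∀ {a b w x y} → Q a w → Q b w → Q a x → Q b y → Q b x ⊎ Q a y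
  n3 {a} {b} {w} {x} {y} aw bw ax by
    with ancestors-comparable (≼-lcaʳ (pos a) (pos w)) (≼-lcaʳ (pos b) (pos w))
  ... | inj₁ aw≼bw = inj₁ (closer-quasiBestMatch bw σx≡σw (lca-least (≼-lcaˡ (pos b) (pos w))
          (≼-trans (≼-lcaʳ (pos a) (pos x)) (≼-trans (best ax w (sym σx≡σw)) aw≼bw))))
    where
    σx≡σw : σ x ≡ σ w
    σx≡σw = ≢-≢⇒≡ (≢-sym (colors-differ ax)) (colors-differ aw)
  ... | inj₂ bw≼aw = inj₂ (closer-quasiBestMatch aw σy≡σw (lca-least (≼-lcaˡ (pos a) (pos w))
          (≼-trans (≼-lcaʳ (pos b) (pos y)) (≼-trans (best by w (sym σy≡σw)) bw≼aw))))
    where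
    σy≡σw : σ y ≡ σ w
    σy≡σw = ≢-≢⇒≡ (≢-sym (colors-differ by)) (colors-differ bw)

  qbmgProperties : QBMGProperties Q
  qbmgProperties = record { n1 = n1 ; n2 = n2 ; n3 = n3 }

2qBMG⇒QBMGProperties : ∀ {n} {D : ColDigraph n} → Is2qBMG D → QBMGProperties (ColDigraph.Arc D)
2qBMG⇒QBMGProperties {D = D} (t , φ , uT , arc⇔qbm) =
  QBMGProperties-⇔ arc⇔qbm
    (QBMGProperties-comap (Inverse.to φ)
      (QuasiBestMatchGraph.qbmgProperties (ColDigraph.col D ∘ Inverse.from φ) uT))

Adj : ∀ {V : Set} → (V → V → Set) → V → V → Set
Adj R x y = R x y ⊎ R y x

module _ {V : Set} {A : V → V → Set} (P : QBMGProperties A) where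
  open QBMGProperties P

  inducedP₅-no-arc-into-middle : ∀ {p x y z q} →
    Adj A p x → A x y → Adj A y z → Adj A z q → ¬ Adj A p z → ¬ Adj A x q → ⊥
  inducedP₅-no-arc-into-middle px xy (inj₁ yz) zq ¬pz ¬xq with zq
  ... | inj₁ z→q = ¬xq (inj₁ (n2 xy yz z→q))
  ... | inj₂ q→z = n1 xy q→z yz (¬xq ∘ inj₁) (¬xq ∘ inj₂)
  inducedP₅-no-arc-into-middle (inj₁ p→x) xy (inj₂ zy) zq ¬pz ¬xq =
    n1 p→x zy xy (¬pz ∘ inj₁) (¬pz ∘ inj₂)
  inducedP₅-no-arc-into-middle (inj₂ x→p) xy (inj₂ zy) (inj₂ q→z) ¬pz ¬xq =
    n1 q→z xy zy (¬xq ∘ inj₂) (¬xq ∘ inj₁)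
  inducedP₅-no-arc-into-middle (inj₂ x→p) xy (inj₂ zy) (inj₁ z→q) ¬pz ¬xq
    with n3 xy zy x→p z→q
  ... | inj₁ z→p = ¬pz (inj₂ z→p)
  ... | inj₂ x→q = ¬xq (inj₁ x→q)

edge : ∀ {n} {G : Graph n} (E? : ∀ i j → Dec (Graph.E G i j)) i j →
       {True (E? i j)} → Graph.E G i j
edge E? i j {i~j} = toWitness i~j

non-edge : ∀ {n} {G : Graph n} (E? : ∀ i j → Dec (Graph.E G i j)) i j →
           {False (E? i j)} → ¬ Graph.E G i j
non-edge E? i j {i≁j} = toWitnessFalse i≁j

Sunlet4-edge? : ∀ i j → Dec (Graph.E Sunlet4 i j)
Sunlet4-edge? = edgeIn? _

Sunlet4-not-orientable : {A : Fin 8 → Fin 8 → Set} → QBMGProperties A →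
                         (∀ i j → Graph.E Sunlet4 i j ⇔ Adj A i j) → ⊥
Sunlet4-not-orientable {A} P E⇔Adj = [ no-arc₁₂ , no-arc₂₁ ] (adj 1F 2F)
  where
  adj : ∀ i j → {True (Sunlet4-edge? i j)} → Adj A i j
  adj i j {i~j} = Equivalence.to (E⇔Adj i j) (edge {G = Sunlet4} Sunlet4-edge? i j {i~j})
  non-adj : ∀ i j → {False (Sunlet4-edge? i j)} → ¬ Adj A i j
  non-adj i j {i≁j} =
    non-edge {G = Sunlet4} Sunlet4-edge? i j {i≁j} ∘ Equivalence.from (E⇔Adj i j)
  no-arc₁₂ : ¬ A 1F 2F
  no-arc₁₂ 1→2 = inducedP₅-no-arc-into-middle P (adj 0F 1F) 1→2 (adj 2F 7F) (adj 7F 6F)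
                   (non-adj 0F 7F) (non-adj 1F 6F)
  no-arc₂₁ : ¬ A 2F 1F
  no-arc₂₁ 2→1 = inducedP₅-no-arc-into-middle P (adj 3F 2F) 2→1 (adj 1F 4F) (adj 4F 5F)
                   (non-adj 3F 4F) (non-adj 2F 5F)

un2qBMG⇒Sunlet4-free : ∀ {n} (G : Graph n) → IsUn2qBMG G → ¬ HasInduced Sunlet4 G
un2qBMG⇒Sunlet4-free G (D , is2qBMG , underlying) (f , _ , induced) =
  Sunlet4-not-orientable
    (QBMGProperties-comap f (2qBMG⇒QBMGProperties {D = D} is2qBMG))
    (λ i j → underlying (f i) (f j) ⇔-∘ induced i j)

HasInduced-refl : ∀ {n} (G : Graph n) → HasInduced G G
HasInduced-refl G = id , id , λ i j → ⇔-id _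

hub : Fin 4 → Fin 8
hub 0F = 1F
hub 1F = 2F
hub 2F = 7F
hub 3F = 4F

IsHub : Fin 8 → Set
IsHub x = ∃ λ h → hub h ≡ x

-- Opaque: otherwise comparing types that mention the hub it returns unfolds
-- the whole enumeration symbolically.
opaque
  two-neighbours⇒hub : ∀ x y z → Graph.E Sunlet4 x y → Graph.E Sunlet4 x z → y ≢ z → IsHub x
  two-neighbours⇒hub = toWitness {a? = all? λ x → all? λ y → all? λ z →
    Sunlet4-edge? x y →-dec Sunlet4-edge? x z →-dec ¬? (y ≟ z) →-dec any? (λ h → hub h ≟ x)} _

-- C₄ = K₂,₂ is bipartite with all edges between the sides, so a walk of
-- odd length between distinct vertices ends at adjacent ones.
hub-walk₃-ends-adjacent : ∀ {w x y z} → IsHub w → IsHub x → IsHub y → IsHub z →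
  Graph.E Sunlet4 w x → Graph.E Sunlet4 x y → Graph.E Sunlet4 y z → w ≢ z →
  Graph.E Sunlet4 w z
hub-walk₃-ends-adjacent (a , refl) (b , refl) (c , refl) (d , refl) = by-enumeration a b c d
  where
  by-enumeration : ∀ a b c d →
    Graph.E Sunlet4 (hub a) (hub b) → Graph.E Sunlet4 (hub b) (hub c) →
    Graph.E Sunlet4 (hub c) (hub d) → hub a ≢ hub d → Graph.E Sunlet4 (hub a) (hub d)
  by-enumeration = toWitness {a? = all? λ a → all? λ b → all? λ c → all? λ d →
    Sunlet4-edge? (hub a) (hub b) →-dec Sunlet4-edge? (hub b) (hub c) →-dec
    Sunlet4-edge? (hub c) (hub d) →-dec ¬? (hub a ≟ hub d) →-dec
    Sunlet4-edge? (hub a) (hub d)} _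

module InducedInSunlet4 {k} {H : Graph k} (H-edge? : ∀ i j → Dec (Graph.E H i j))
                        (embedding : HasInduced H Sunlet4) where

  f : Fin k → Fin 8
  f = proj₁ embedding

  f-injective : ∀ {i j} → f i ≡ f j → i ≡ j
  f-injective = proj₁ (proj₂ embedding)

  image-edge : ∀ i j → {True (H-edge? i j)} → Graph.E Sunlet4 (f i) (f j)
  image-edge i j {i~j} =
    Equivalence.to (proj₂ (proj₂ embedding) i j) (edge {G = H} H-edge? i j {i~j})

  image-non-edge : ∀ i j → {False (H-edge? i j)} → ¬ Graph.E Sunlet4 (f i) (f j)
  image-non-edge i j {i≁j} =
    non-edge {G = H} H-edge? i j {i≁j} ∘ Equivalence.from (proj₂ (proj₂ embedding) i j)

  image-hub : ∀ i j l → {True (H-edge? i j)} → {True (H-edge? i l)} → {False (j ≟ l)} → IsHub (f i)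
  image-hub i j l {i~j} {i~l} {j≢l} =
    two-neighbours⇒hub (f i) (f j) (f l) (image-edge i j {i~j}) (image-edge i l {i~l})
      (toWitnessFalse j≢l ∘ f-injective)

P6-edge? : ∀ i j → Dec (Graph.E P6 i j)
P6-edge? = edgeIn? _

C6-edge? : ∀ i j → Dec (Graph.E C6 i j)
C6-edge? = edgeIn? _

Sunlet4-P₆-free : ¬ HasInduced P6 Sunlet4
Sunlet4-P₆-free embedding =
  image-non-edge 1F 4F (hub-walk₃-ends-adjacent
    (image-hub 1F 0F 2F) (image-hub 2F 1F 3F) (image-hub 3F 2F 4F) (image-hub 4F 3F 5F)
    (image-edge 1F 2F) (image-edge 2F 3F) (image-edge 3F 4F) ((λ ()) ∘ f-injective))
  where open InducedInSunlet4 {H = P6} P6-edge? embedding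

Sunlet4-C₆-free : ¬ HasInduced C6 Sunlet4
Sunlet4-C₆-free embedding =
  let i , j , i<j , same-hub = pigeonhole 4<6 (proj₁ ∘ image-is-hub) in
  <⇒≢ i<j (f-injective (trans (sym (proj₂ (image-is-hub i)))
                              (trans (cong hub same-hub) (proj₂ (image-is-hub j)))))
  where
  open InducedInSunlet4 {H = C6} C6-edge? embedding
  4<6 : 4 < 6
  4<6 = s≤s (s≤s (s≤s (s≤s (s≤s z≤n))))
  image-is-hub : ∀ i → IsHub (f i)
  image-is-hub 0F = image-hub 0F 5F 1F
  image-is-hub 1F = image-hub 1F 0F 2F
  image-is-hub 2F = image-hub 2F 1F 3F
  image-is-hub 3F = image-hub 3F 2F 4F
  image-is-hub 4F = image-hub 4F 3F 5F
  image-is-hub 5F = image-hub 5F 4F 0F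

theorem3p4 : P6C6Free Sunlet4
           × ¬ IsUn2qBMG Sunlet4
           × (∀ {n : ℕ} (G : Graph n) → IsUn2qBMG G → ¬ HasInduced Sunlet4 G)
theorem3p4 =
  (Sunlet4-P₆-free , Sunlet4-C₆-free) ,
  (λ un2qBMG → un2qBMG⇒Sunlet4-free Sunlet4 un2qBMG (HasInduced-refl Sunlet4)) ,
  un2qBMG⇒Sunlet4-free
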